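{- For any integer $n\ge0$ and any non-decreasing sequence $\underline s=(s_1,\dots,s_u)\in S^u$, we have $g^{(\underline s),\dagger}_n(w)=\prod_{i=1}^u g^{(s_i),\dagger}_{n_{u,i}}(w)$.
   Context: Let $p\ge7$ be prime and $k_0\in\{2,\dots,p\}$. Let $\mathcal K=\{k\in\mathbb Z:k\ge2,\ k\equiv k_0\pmod{p-1}\}$ and for $k\in\mathcal K$ put $k_\bullet=(k-k_0)/(p-1)$. For an integer $n$, $\{n\}\in\{0,\dots,p-2\}$ is its residue mod $p-1$. For $s\in\{0,\dots,p-2\}$ put $a_s=\{k_0-2-2s\}$, $\delta_s=0$ if $s+\{a_s+s\}<p-1$ and $\delta_s=1$ otherwise; if $a_s+s<p-1$ put $t_1^{(s)}=s+\delta_s$, $t_2^{(s)}=a_s+s+\delta_s+2$; if $a_s+s\ge p-1$ put $t_1^{(s)}=\{a_s+s\}+\delta_s+1$, $t_2^{(s)}=s+\delta_s+1$. Put $d^{\mathrm{ur}}_k(s)=\lfloor\frac{k_\bullet-t_1^{(s)}}{p+1}\rfloor+\lfloor\frac{k_\bullet-t_2^{(s)}}{p+1}\rfloor+2$ and $d^{\mathrm{ur},\dagger}_k(s)=d^{\mathrm{ur}}_k(s)+\delta_s$, $d^{\mathrm{Iw},\dagger}_k=2k_\bullet+2$. For $\underline s=(s_1,\dots,s_u)$ put $d^{\mathrm{ur},\dagger}_k(\underline s)=\sum_i d^{\mathrm{ur},\dagger}_k(s_i)$ and $d^{\mathrm{Iw},\dagger}_k(\underline s)=u(2k_\bullet+2)$;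 let $m^{(\underline s),\dagger}_n(k)=\min\{n-d^{\mathrm{ur},\dagger}_k(\underline s),\,d^{\mathrm{Iw},\dagger}_k(\underline s)-d^{\mathrm{ur},\dagger}_k(\underline s)-n\}$ if $d^{\mathrm{ur},\dagger}_k(\underline s)<n<d^{\mathrm{Iw},\dagger}_k(\underline s)-d^{\mathrm{ur},\dagger}_k(\underline s)$ and $0$ otherwise; $w_k=\exp((k-2)p)-1$; and $g^{(\underline s),\dagger}_n(w)=\prod_{k\in\mathcal K}(w-w_k)^{m^{(\underline s),\dagger}_n(k)}\in\mathbb Z_p[w]$. For a single $s$ write $g^{(s),\dagger}_n$. Let $S=\{\lceil\frac{k_0+1}2\rceil,\dots,\lfloor\frac{k_0+p-4}2\rfloor\}$. For $n\ge0$, $u\ge1$ and $q=\lfloor n/u\rfloor$: if $q$ is even, $n_{u,i}=q$ for $1\le i\le u(q+1)-n$ and $n_{u,i}=q+1$ for the remaining $i\le u$; if $q$ is odd, $n_{u,i}=q+1$ for $1\le i\le n-uq$ and $n_{u,i}=q$ for the remaining $i\le u$. -}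

module Defs where

open import Data.Nat as ℕ using (ℕ; zero; suc; _∸_)
open import Data.Integer as ℤ using (ℤ; +_; _%ℕ_; _/ℕ_)
open import Data.Integer.Properties as ℤP using ()
open import Data.Fin using (Fin; toℕ)
import Data.Fin as F
open import Data.Product using (_×_)
open import Data.Bool using (Bool; true; false; if_then_else_; _∧_)
open import Relation.Nullary.Decidable using (does)

-- Arithmetic conventions (p ≥ 7 is assumed in the statement, so p ∸ 1 = p - 1 ≥ 1)

res : (p : ℕ) → ℤ → ℕ
res p x = x %ℕ suc (p ∸ 2)          -- suc (p ∸ 2) = p - 1 for p ≥ 2

-- ⌊ x / (p+1) ⌋ (floor division, also for negative x)
floorP1 : (p : ℕ) → ℤ → ℤ
floorP1 p x = x /ℕ suc p

-- Weights k ∈ 𝒦 are k = k0 + (p-1) j  (j ∈ ℕ), and then k_• = j.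

a : (p k0 s : ℕ) → ℕ
a p k0 s = res p (+ k0 ℤ.- + 2 ℤ.- + (2 ℕ.* s))

δ : (p k0 s : ℕ) → ℕ
δ p k0 s =
  if does (s ℕ.+ res p (+ (a p k0 s ℕ.+ s)) ℕ.<? (p ∸ 1)) then 0 else 1

t₁ : (p k0 s : ℕ) → ℕ
t₁ p k0 s =
  if does (a p k0 s ℕ.+ s ℕ.<? (p ∸ 1))
  then s ℕ.+ δ p k0 s
  else res p (+ (a p k0 s ℕ.+ s)) ℕ.+ δ p k0 s ℕ.+ 1

t₂ : (p k0 s : ℕ) → ℕ
t₂ p k0 s =
  if does (a p k0 s ℕ.+ s ℕ.<? (p ∸ 1))
  then a p k0 s ℕ.+ s ℕ.+ δ p k0 s ℕ.+ 2
  else s ℕ.+ δ p k0 s ℕ.+ 1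

dur : (p k0 s j : ℕ) → ℤ
dur p k0 s j =
  floorP1 p (+ j ℤ.- + t₁ p k0 s) ℤ.+ floorP1 p (+ j ℤ.- + t₂ p k0 s) ℤ.+ + 2

durd : (p k0 s j : ℕ) → ℤ
durd p k0 s j = dur p k0 s j ℤ.+ + δ p k0 s

dIwd : (j : ℕ) → ℤ
dIwd j = + (2 ℕ.* j ℕ.+ 2)

sumFin : (u : ℕ) → (Fin u → ℤ) → ℤ
sumFin zero    f = + 0
sumFin (suc u) f = f F.zero ℤ.+ sumFin u (λ i → f (F.suc i))

durdT : (p k0 u : ℕ) → (Fin u → ℕ) → (j : ℕ) → ℤ
durdT p k0 u s j = sumFin u (λ i → durd p k0 (s i) j)

dIwdT : (u j : ℕ) → ℤ
dIwdT u j = + u ℤ.* dIwd j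

mShape : (D I : ℤ) → (n : ℕ) → ℤ
mShape D I n =
  if does (D ℤP.<? + n) ∧ does (+ n ℤP.<? I ℤ.- D)
  then (+ n ℤ.- D) ℤ.⊓ (I ℤ.- D ℤ.- + n)
  else + 0

mT : (p k0 n u : ℕ) → (Fin u → ℕ) → (j : ℕ) → ℤ
mT p k0 n u s j = mShape (durdT p k0 u s j) (dIwdT u j) n

m1 : (p k0 n s j : ℕ) → ℤ
m1 p k0 n s j = mShape (durd p k0 s j) (dIwd j) n

-- Polynomials g = ∏_{k∈𝒦} (w - w_k)^{m(k)} are represented by their exponent
-- function j ↦ m(k0 + (p-1) j)  (the w_k are pairwise distinct, so this is
-- a faithful, multiplicative encoding: products of g's = pointwise sums).

ExpPoly : Set
ExpPoly = ℕ → ℤ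

gT : (p k0 n u : ℕ) → (Fin u → ℕ) → ExpPoly
gT p k0 n u s = mT p k0 n u s

g1 : (p k0 n s : ℕ) → ExpPoly
g1 p k0 n s = m1 p k0 n s

prodFin : (u : ℕ) → (Fin u → ExpPoly) → ExpPoly
prodFin u G j = sumFin u (λ i → G i j)

-- S = {⌈(k0+1)/2⌉, …, ⌊(k0+p-4)/2⌋}
inS : (p k0 s : ℕ) → Set
inS p k0 s = ((k0 ℕ.+ 2) ℕ./ 2 ℕ.≤ s) × (s ℕ.≤ (k0 ℕ.+ p ∸ 4) ℕ./ 2)

-- n_{u,i}  (i ∈ {1,…,u}; u ≥ 1 is assumed in the statement)
nui : (n u i : ℕ) → ℕ
nui n zero    i = 0
nui n (suc v) i =
  let u = suc v ; q = n ℕ./ u in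
  if does (q ℕ.% 2 ℕ.≟ 0)
  then (if does (i ℕ.≤? u ℕ.* (q ℕ.+ 1) ∸ n) then q else q ℕ.+ 1)
  else (if does (i ℕ.≤? n ∸ u ℕ.* q) then q ℕ.+ 1 else q)

{-# OPTIONS --safe #-}
-- Write k_• = r + m (p + 1) with 0 ≤ r ≤ p. For s ∈ S the thresholds t₁, t₂ have closed forms in
-- [1, p + 1], so d^{ur,†}_k(s) = 2m + e(s) with e(s) = δ_s + [t₁ ≤ r] + [t₂ ≤ r], while
-- d^{Iw,†}_k = 2 (k_• + 1) and m_n = max(0, τ) for the tent τ = min(n − D, I − D − n).
-- Since every n_{u,i} lies in {q, q + 1}, all of them lie on the same side of k_• + 1, so the same
-- branch of every tent is active and the tents add up.  It remains to see that
-- Σ max(0, τᵢ) = max(0, Σ τᵢ), i.e. that no two τᵢ have strictly opposite signs.  For i ≤ i′, both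
-- n_{u,i} ↦ n_{u,i′} and e(sᵢ) ↦ e(s_{i′}) are steps by at most 1 which, when nonzero, start from an
-- even value (this is where the parity rule for n_{u,i} and the monotonicity of s are used); hence
-- corresponding slopes of τᵢ and τ_{i′} differ by at most 1 or are of the form 2t, 2t ± 2.
module Submission where

open import Data.Bool using (if_then_else_)
open import Data.Empty using (⊥-elim)
open import Data.Fin as F using (Fin; toℕ)
import Data.Fin.Properties as FP
open import Data.Nat as ℕ using (ℕ; zero; suc)
open import Data.Nat.DivMod using (_/_; _%_; m<n⇒m%n≡m; [m+n]%n≡m%n; m≡m%n+[m/n]*n; m%n<n; m/n*n≤m)
import Data.Nat.Properties as ℕP
open import Data.Nat.Primality using (Prime)
import Data.Nat.Tactic.RingSolver as ℕ-Solver
import Data.Integer as ℤ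
import Data.Integer.Properties as ℤP
import Data.Integer.Tactic.RingSolver as ℤ-Solver
open import Data.Product using (_×_; _,_; proj₁; proj₂; swap)
open import Data.Integer.DivMod using (a≡a%ℕn+[a/ℕn]*n; n%ℕd<d)
open import Data.Sum as Sum using (_⊎_; inj₁; inj₂)
open import Relation.Binary using (tri<; tri≈; tri>)
open import Relation.Binary.PropositionalEquality
open import Relation.Nullary using (¬_; Dec; yes; no)
open import Relation.Nullary.Decidable using (does; dec-true; dec-false)
open import Defs

module Tent where
  open ℤ hiding (suc)
  open ℤP
  open ℤ-Solver using (solve-∀)

  SignCompatible : ℤ → ℤ → Set
  SignCompatible a b = (0ℤ < a → 0ℤ ≤ b) × (0ℤ < b → 0ℤ ≤ a)

  signCompatible-refl : ∀ a → SignCompatible a a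
  signCompatible-refl a = <⇒≤ , <⇒≤

  signCompatible-suc : ∀ a → SignCompatible a (a + 1ℤ)
  signCompatible-suc (+ n)            = (λ _ → +≤+ ℕ.z≤n) , (λ _ → +≤+ ℕ.z≤n)
  signCompatible-suc -[1+ zero ]      = (λ ()) , λ { (+<+ ()) }
  signCompatible-suc -[1+ suc n ]     = (λ ()) , (λ ())

  signCompatible-double : ∀ t → SignCompatible (t + t) (t + t + + 2)
  signCompatible-double (+ n)         = (λ _ → +≤+ ℕ.z≤n) , (λ _ → +≤+ ℕ.z≤n)
  signCompatible-double -[1+ zero ]   = (λ ()) , λ { (+<+ ()) }
  signCompatible-double -[1+ suc n ]  = (λ ()) , (λ ())

  signCompatible-⊓ : ∀ {a b a′ b′} → SignCompatible a b → SignCompatible a′ b′ →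
                     SignCompatible (a ⊓ a′) (b ⊓ b′)
  signCompatible-⊓ {a} {b} {a′} {b′} (a⇒b , b⇒a) (a′⇒b′ , b′⇒a′) =
    (λ 0<a⊓a′ → ⊓-glb (a⇒b (<-≤-trans 0<a⊓a′ (i⊓j≤i a a′))) (a′⇒b′ (<-≤-trans 0<a⊓a′ (i⊓j≤j a a′)))) ,
    (λ 0<b⊓b′ → ⊓-glb (b⇒a (<-≤-trans 0<b⊓b′ (i⊓j≤i b b′))) (b′⇒a′ (<-≤-trans 0<b⊓b′ (i⊓j≤j b b′))))

  data EvenStep : ℤ → ℤ → Set where
    stay : ∀ {x} → EvenStep x x
    up   : ∀ a → EvenStep (a + a) (a + a + 1ℤ)
    down : ∀ a → EvenStep (a + a) (a + a - 1ℤ)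

  evenStep-neg : ∀ {x y} → EvenStep x y → EvenStep (- x) (- y)
  evenStep-neg stay     = stay
  evenStep-neg (up a)   = subst₂ EvenStep (eqˡ a) (eqʳ a) (down (- a))
    where
    eqˡ : ∀ a → - a + - a ≡ - (a + a)
    eqˡ = solve-∀
    eqʳ : ∀ a → - a + - a - 1ℤ ≡ - (a + a + 1ℤ)
    eqʳ = solve-∀
  evenStep-neg (down a) = subst₂ EvenStep (eqˡ a) (eqʳ a) (up (- a))
    where
    eqˡ : ∀ a → - a + - a ≡ - (a + a)
    eqˡ = solve-∀
    eqʳ : ∀ a → - a + - a + 1ℤ ≡ - (a + a - 1ℤ)
    eqʳ = solve-∀

  -- Two steps change the sum by at most 2, and by exactly ±2 only from an even value.
  signCompatible-evenStep : ∀ c {x y x′ y′} → EvenStep x y → EvenStep x′ y′ →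
                            SignCompatible (c + c + (x + x′)) (c + c + (y + y′))
  signCompatible-evenStep c stay stay = signCompatible-refl _
  signCompatible-evenStep c {x} stay (up b) =
    subst (SignCompatible _) (eq c x b) (signCompatible-suc _)
    where
    eq : ∀ c x b → c + c + (x + (b + b)) + 1ℤ ≡ c + c + (x + (b + b + 1ℤ))
    eq = solve-∀
  signCompatible-evenStep c {x} stay (down b) =
    swap (subst (SignCompatible _) (eq c x b) (signCompatible-suc _))
    where
    eq : ∀ c x b → c + c + (x + (b + b - 1ℤ)) + 1ℤ ≡ c + c + (x + (b + b))
    eq = solve-∀
  signCompatible-evenStep c {x′ = x′} (up a) stay =
    subst (SignCompatible _) (eq c a x′) (signCompatible-suc _)
    where
    eq : ∀ c a x′ → c + c + (a + a + x′) + 1ℤ ≡ c + c + (a + a + 1ℤ + x′)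
    eq = solve-∀
  signCompatible-evenStep c {x′ = x′} (down a) stay =
    swap (subst (SignCompatible _) (eq c a x′) (signCompatible-suc _))
    where
    eq : ∀ c a x′ → c + c + (a + a - 1ℤ + x′) + 1ℤ ≡ c + c + (a + a + x′)
    eq = solve-∀
  signCompatible-evenStep c (up a) (up b) =
    subst₂ SignCompatible (eqˡ c a b) (eqʳ c a b) (signCompatible-double (c + a + b))
    where
    eqˡ : ∀ c a b → (c + a + b) + (c + a + b) ≡ c + c + (a + a + (b + b))
    eqˡ = solve-∀
    eqʳ : ∀ c a b → (c + a + b) + (c + a + b) + + 2 ≡ c + c + (a + a + 1ℤ + (b + b + 1ℤ))
    eqʳ = solve-∀
  signCompatible-evenStep c (up a) (down b) =
    subst (SignCompatible _) (eq c a b) (signCompatible-refl _)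
    where
    eq : ∀ c a b → c + c + (a + a + (b + b)) ≡ c + c + (a + a + 1ℤ + (b + b - 1ℤ))
    eq = solve-∀
  signCompatible-evenStep c (down a) (up b) =
    subst (SignCompatible _) (eq c a b) (signCompatible-refl _)
    where
    eq : ∀ c a b → c + c + (a + a + (b + b)) ≡ c + c + (a + a - 1ℤ + (b + b + 1ℤ))
    eq = solve-∀
  signCompatible-evenStep c (down a) (down b) =
    swap (subst₂ SignCompatible (eqˡ c a b) (eqʳ c a b) (signCompatible-double (c + a + b - 1ℤ)))
    where
    eqˡ : ∀ c a b → (c + a + b - 1ℤ) + (c + a + b - 1ℤ) ≡ c + c + (a + a - 1ℤ + (b + b - 1ℤ))
    eqˡ = solve-∀
    eqʳ : ∀ c a b → (c + a + b - 1ℤ) + (c + a + b - 1ℤ) + + 2 ≡ c + c + (a + a + (b + b))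
    eqʳ = solve-∀

  tent : ℤ → ℤ → ℤ → ℤ
  tent D I N = (N - D) ⊓ (I - D - N)

  mShape≡0⊔tent : ∀ D I n → mShape D I n ≡ 0ℤ ⊔ tent D I (+ n)
  mShape≡0⊔tent D I n with D <? + n | + n <? I - D
  ... | yes D<n | yes n<I-D =
    sym (i≤j⇒i⊔j≡j (⊓-glb (i≤j⇒0≤j-i (<⇒≤ D<n)) (i≤j⇒0≤j-i (<⇒≤ n<I-D))))
  ... | yes _   | no n≮I-D  = sym (i≥j⇒i⊔j≡i (≤-trans (i⊓j≤j _ _) (i≤j⇒i-j≤0 (≮⇒≥ n≮I-D))))
  ... | no D≮n  | _         = sym (i≥j⇒i⊔j≡i (≤-trans (i⊓j≤i _ _) (i≤j⇒i-j≤0 (≮⇒≥ D≮n))))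

  -- Both slopes N − (M + M + E) and c + c − (M + M + E) − N are an even number plus a sum of two steps.
  signCompatible-tent : ∀ c M {N N′ E E′} → EvenStep N N′ → EvenStep E E′ →
    SignCompatible (tent (M + M + E) (c + c) N) (tent (M + M + E′) (c + c) N′)
  signCompatible-tent c M {N} {N′} {E} {E′} N~N′ E~E′ = signCompatible-⊓
    (subst₂ SignCompatible (ascending M N E) (ascending M N′ E′)
      (signCompatible-evenStep (- M) N~N′ (evenStep-neg E~E′)))
    (subst₂ SignCompatible (descending c M N E) (descending c M N′ E′)
      (signCompatible-evenStep (c - M) (evenStep-neg E~E′) (evenStep-neg N~N′)))
    where
    ascending : ∀ M N E → - M + - M + (N + - E) ≡ N - (M + M + E)
    ascending = solve-∀
    descending : ∀ c M N E → c - M + (c - M) + (- E + - N) ≡ c + c - (M + M + E) - N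
    descending = solve-∀

  tent-ascending : ∀ D I N → N + N ≤ I → tent D I N ≡ N - D
  tent-ascending D I N 2N≤I = i≤j⇒i⊓j≡i (0≤i-j⇒j≤i (subst (0ℤ ≤_) (eq N D I) (i≤j⇒0≤j-i 2N≤I)))
    where
    eq : ∀ N D I → I - (N + N) ≡ I - D - N - (N - D)
    eq = solve-∀

  tent-descending : ∀ D I N → I ≤ N + N → tent D I N ≡ I - D - N
  tent-descending D I N I≤2N = i≥j⇒i⊓j≡j (0≤i-j⇒j≤i (subst (0ℤ ≤_) (eq N D I) (i≤j⇒0≤j-i I≤2N)))
    where
    eq : ∀ N D I → N + N - I ≡ N - D - (I - D - N)
    eq = solve-∀

module Sums where
  open ℤ hiding (suc)
  open ℤP
  open Tent
  open ℤ-Solver using (solve-∀)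

  sumFin-cong : ∀ u {f g : Fin u → ℤ} → (∀ i → f i ≡ g i) → sumFin u f ≡ sumFin u g
  sumFin-cong zero    f≡g = refl
  sumFin-cong (suc u) f≡g = cong₂ _+_ (f≡g F.zero) (sumFin-cong u (λ i → f≡g (F.suc i)))

  sumFin-add : ∀ u (f g : Fin u → ℤ) → sumFin u (λ i → f i + g i) ≡ sumFin u f + sumFin u g
  sumFin-add zero    f g = refl
  sumFin-add (suc u) f g = trans (cong (_+_ (f F.zero + g F.zero)) (sumFin-add u (λ i → f (F.suc i)) (λ i → g (F.suc i))))
                               (interchange (f F.zero) (g F.zero) _ _)
    where
    interchange : ∀ a b c d → a + b + (c + d) ≡ a + c + (b + d)
    interchange = solve-∀

  sumFin-sub : ∀ u (f g : Fin u → ℤ) → sumFin u (λ i → f i - g i) ≡ sumFin u f - sumFin u g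
  sumFin-sub zero    f g = refl
  sumFin-sub (suc u) f g = trans (cong (_+_ (f F.zero - g F.zero)) (sumFin-sub u (λ i → f (F.suc i)) (λ i → g (F.suc i))))
                               (interchange (f F.zero) (g F.zero) _ _)
    where
    interchange : ∀ a b c d → a - b + (c - d) ≡ a + c - (b + d)
    interchange = solve-∀

  sumFin-const : ∀ u x → sumFin u (λ _ → x) ≡ + u * x
  sumFin-const zero    x = sym (*-zeroˡ x)
  sumFin-const (suc u) x = begin
    x + sumFin u (λ _ → x) ≡⟨ cong (_+_ x) (sumFin-const u x) ⟩
    x + + u * x            ≡⟨ e x (+ u) ⟩
    (1ℤ + + u) * x         ≡⟨ cong (_* x) (sym (pos-+ 1 u)) ⟩
    + suc u * x            ∎
    where
    open ≡-Reasoning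
    e : ∀ x v → x + v * x ≡ (1ℤ + v) * x
    e = solve-∀

  sumFin-mono : ∀ u {f g : Fin u → ℤ} → (∀ i → f i ≤ g i) → sumFin u f ≤ sumFin u g
  sumFin-mono zero    f≤g = ≤-refl
  sumFin-mono (suc u) f≤g = +-mono-≤ (f≤g F.zero) (sumFin-mono u (λ i → f≤g (F.suc i)))

  sumFin-nonneg : ∀ u {f : Fin u → ℤ} → (∀ i → 0ℤ ≤ f i) → 0ℤ ≤ sumFin u f
  sumFin-nonneg u {f} 0≤f = subst (_≤ sumFin u f) (trans (sumFin-const u 0ℤ) (*-zeroʳ (+ u))) (sumFin-mono u 0≤f)

  sumFin-nonpos : ∀ u {f : Fin u → ℤ} → (∀ i → f i ≤ 0ℤ) → sumFin u f ≤ 0ℤ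
  sumFin-nonpos u {f} f≤0 = subst (sumFin u f ≤_) (trans (sumFin-const u 0ℤ) (*-zeroʳ (+ u))) (sumFin-mono u f≤0)

  sumFin-0⊔ : ∀ u (c : Fin u → ℤ) → (∀ i k → SignCompatible (c i) (c k)) →
              sumFin u (λ i → 0ℤ ⊔ c i) ≡ 0ℤ ⊔ sumFin u c
  sumFin-0⊔ u c compatible with FP.any? (λ i → 0ℤ <? c i)
  ... | yes (i , 0<cᵢ) = trans (sumFin-cong u (λ k → i≤j⇒i⊔j≡j (0≤c k)))
                               (sym (i≤j⇒i⊔j≡j (sumFin-nonneg u 0≤c)))
    where
    0≤c : ∀ k → 0ℤ ≤ c k
    0≤c k = proj₁ (compatible i k) 0<cᵢ
  ... | no ∄0<c = trans (sumFin-cong u (λ k → i≥j⇒i⊔j≡i (c≤0 k)))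
                        (trans (trans (sumFin-const u 0ℤ) (*-zeroʳ (+ u)))
                               (sym (i≥j⇒i⊔j≡i (sumFin-nonpos u c≤0))))
    where
    c≤0 : ∀ k → c k ≤ 0ℤ
    c≤0 k = ≮⇒≥ (λ 0<cₖ → ∄0<c (k , 0<cₖ))

  sumFin-tent : ∀ u (D : Fin u → ℤ) I (N : Fin u → ℤ) →
    (∀ i → N i + N i ≤ I) ⊎ (∀ i → I ≤ N i + N i) →
    sumFin u (λ i → tent (D i) I (N i)) ≡ tent (sumFin u D) (+ u * I) (sumFin u N)
  sumFin-tent u D I N (inj₁ 2N≤I) = begin
    sumFin u (λ i → tent (D i) I (N i))      ≡⟨ sumFin-cong u (λ i → tent-ascending (D i) I (N i) (2N≤I i)) ⟩
    sumFin u (λ i → N i - D i)               ≡⟨ sumFin-sub u N D ⟩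
    sumFin u N - sumFin u D                  ≡⟨ sym (tent-ascending _ _ _ total) ⟩
    tent (sumFin u D) (+ u * I) (sumFin u N) ∎
    where
    open ≡-Reasoning
    total : sumFin u N + sumFin u N ≤ + u * I
    total = subst₂ _≤_ (sumFin-add u N N) (sumFin-const u I) (sumFin-mono u 2N≤I)
  sumFin-tent u D I N (inj₂ I≤2N) = begin
    sumFin u (λ i → tent (D i) I (N i))          ≡⟨ sumFin-cong u (λ i → tent-descending (D i) I (N i) (I≤2N i)) ⟩
    sumFin u (λ i → I - D i - N i)               ≡⟨ sumFin-sub u (λ i → I - D i) N ⟩
    sumFin u (λ i → I - D i) - sumFin u N        ≡⟨ cong (_- sumFin u N) (sumFin-sub u (λ _ → I) D) ⟩
    sumFin u (λ _ → I) - sumFin u D - sumFin u N ≡⟨ cong (λ x → x - sumFin u D - sumFin u N) (sumFin-const u I) ⟩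
    + u * I - sumFin u D - sumFin u N            ≡⟨ sym (tent-descending _ _ _ total) ⟩
    tent (sumFin u D) (+ u * I) (sumFin u N)     ∎
    where
    open ≡-Reasoning
    total : + u * I ≤ sumFin u N + sumFin u N
    total = subst₂ _≤_ (sumFin-const u I) (sumFin-add u N N) (sumFin-mono u I≤2N)

  mShape-sumFin : ∀ u (D : Fin u → ℤ) I (ns : Fin u → ℕ) n →
    sumFin u (λ i → + ns i) ≡ + n →
    (∀ i → + ns i + + ns i ≤ I) ⊎ (∀ i → I ≤ + ns i + + ns i) →
    (∀ i k → i F.≤ k → SignCompatible (tent (D i) I (+ ns i)) (tent (D k) I (+ ns k))) →
    mShape (sumFin u D) (+ u * I) n ≡ sumFin u (λ i → mShape (D i) I (ns i))
  mShape-sumFin u D I ns n Σns≡n sameSide ordered = begin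
    mShape (sumFin u D) (+ u * I) n                      ≡⟨ mShape≡0⊔tent (sumFin u D) (+ u * I) n ⟩
    0ℤ ⊔ tent (sumFin u D) (+ u * I) (+ n)               ≡⟨ cong (λ N → 0ℤ ⊔ tent (sumFin u D) (+ u * I) N) (sym Σns≡n) ⟩
    0ℤ ⊔ tent (sumFin u D) (+ u * I) (sumFin u N)        ≡⟨ cong (0ℤ ⊔_) (sym (sumFin-tent u D I N sameSide)) ⟩
    0ℤ ⊔ sumFin u (λ i → tent (D i) I (N i))             ≡⟨ sym (sumFin-0⊔ u _ compatible) ⟩
    sumFin u (λ i → 0ℤ ⊔ tent (D i) I (N i))             ≡⟨ sumFin-cong u (λ i → sym (mShape≡0⊔tent (D i) I (ns i))) ⟩
    sumFin u (λ i → mShape (D i) I (ns i))               ∎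
    where
    open ≡-Reasoning
    N : Fin u → ℤ
    N i = + ns i
    compatible : ∀ i k → SignCompatible (tent (D i) I (N i)) (tent (D k) I (N k))
    compatible i k with FP.≤-total i k
    ... | inj₁ i≤k = ordered i k i≤k
    ... | inj₂ k≤i = swap (ordered k i k≤i)

if-yes : ∀ {P : Set} {A : Set} (d : Dec P) {x y : A} → P → (if does d then x else y) ≡ x
if-yes d p = cong (if_then _ else _) (dec-true d p)

if-no : ∀ {P : Set} {A : Set} (d : Dec P) {x y : A} → ¬ P → (if does d then x else y) ≡ y
if-no d ¬p = cong (if_then _ else _) (dec-false d ¬p)

𝟙[_≤_] : ℕ → ℕ → ℕ
𝟙[ t ≤ r ] = if does (t ℕ.≤? r) then 1 else 0

𝟙-≤ : ∀ {t r} → t ℕ.≤ r → 𝟙[ t ≤ r ] ≡ 1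
𝟙-≤ {t} {r} = if-yes (t ℕ.≤? r)

𝟙-≰ : ∀ {t r} → ¬ t ℕ.≤ r → 𝟙[ t ≤ r ] ≡ 0
𝟙-≰ {t} {r} = if-no (t ℕ.≤? r)

excess : ℕ → ℕ → ℕ → ℕ → ℕ
excess p k0 s r = δ p k0 s ℕ.+ 𝟙[ t₁ p k0 s ≤ r ] ℕ.+ 𝟙[ t₂ p k0 s ≤ r ]

module Floor where
  open ℤ hiding (suc)
  open ℤP
  open ℤ-Solver using (solve-∀)

  private
    +ρ+k*d<+ρ′+k′*d : ∀ d ρ ρ′ k k′ → ρ ℕ.< d → k < k′ → + ρ + k * + d < + ρ′ + k′ * + d
    +ρ+k*d<+ρ′+k′*d d ρ ρ′ k k′ ρ<d k<k′ = begin-strict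
      + ρ + k * + d    <⟨ +-monoˡ-< (k * + d) (+<+ ρ<d) ⟩
      + d + k * + d    ≡⟨ distrib k (+ d) ⟩
      (k + 1ℤ) * + d   ≤⟨ *-monoʳ-≤-nonNeg (+ d) (subst (_≤ k′) (+-comm 1ℤ k) (i<j⇒suc[i]≤j k<k′)) ⟩
      k′ * + d         ≤⟨ i≤j+i (k′ * + d) (+ ρ′) ⟩
      + ρ′ + k′ * + d  ∎
      where
      open ≤-Reasoning
      distrib : ∀ k d → d + k * d ≡ (k + 1ℤ) * d
      distrib = solve-∀

    +-cancelʳ : ∀ {a b} c → a + c ≡ b + c → a ≡ b
    +-cancelʳ {a} {b} c a+c≡b+c = begin
      a         ≡⟨ cancel a c ⟩
      a + c - c ≡⟨ cong (_- c) a+c≡b+c ⟩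
      b + c - c ≡⟨ sym (cancel b c) ⟩
      b         ∎
      where
      open ≡-Reasoning
      cancel : ∀ a c → a ≡ a + c - c
      cancel = solve-∀

    pos-+-* : ∀ r m d → + (r ℕ.+ m ℕ.* d) ≡ + r + + m * + d
    pos-+-* r m d = trans (pos-+ r (m ℕ.* d)) (cong (_+_ (+ r)) (pos-* m d))

    pos-∸ : ∀ {a b} → b ℕ.≤ a → + a - + b ≡ + (a ℕ.∸ b)
    pos-∸ {a} {b} b≤a = trans (m-n≡m⊖n a b) (⊖-≥ b≤a)

  /ℕ-%ℕ-unique : ∀ x d .{{_ : ℕ.NonZero d}} k ρ → ρ ℕ.< d → x ≡ + ρ + k * + d →
                 x /ℕ d ≡ k × x %ℕ d ≡ ρ
  /ℕ-%ℕ-unique x d k ρ ρ<d x≡ρ+kd = quotient , +-injective (+-cancelʳ (k * + d) remainder)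
    where
    x≡r+qd : x ≡ + (x %ℕ d) + (x /ℕ d) * + d
    x≡r+qd = a≡a%ℕn+[a/ℕn]*n x d
    quotient : x /ℕ d ≡ k
    quotient with <-cmp k (x /ℕ d)
    ... | tri< k<q _ _ = ⊥-elim (<-irrefl (trans (sym x≡ρ+kd) x≡r+qd)
                                  (+ρ+k*d<+ρ′+k′*d d ρ (x %ℕ d) k (x /ℕ d) ρ<d k<q))
    ... | tri≈ _ k≡q _ = sym k≡q
    ... | tri> _ _ q<k = ⊥-elim (<-irrefl (trans (sym x≡r+qd) x≡ρ+kd)
                                  (+ρ+k*d<+ρ′+k′*d d (x %ℕ d) ρ (x /ℕ d) k (n%ℕd<d x d) q<k))
    remainder : + (x %ℕ d) + k * + d ≡ + ρ + k * + d
    remainder = trans (cong (λ q → + (x %ℕ d) + q * + d) (sym quotient)) (trans (sym x≡r+qd) x≡ρ+kd)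

  -- For 0 ≤ r ≤ p and 0 ≤ t ≤ p + 1, the value r − t lies in [−(p+1), p], so its floor
  -- quotient by p + 1 is 0 or −1 according as t ≤ r.
  floorP1-shift : ∀ p m r t → t ℕ.≤ suc p → r ℕ.≤ p →
                  floorP1 p (+ (r ℕ.+ m ℕ.* suc p) - + t) ≡ + m + + 𝟙[ t ≤ r ] - 1ℤ
  floorP1-shift p m r t t≤1+p r≤p with t ℕ.≤? r
  ... | yes t≤r rewrite 𝟙-≤ t≤r =
    proj₁ (/ℕ-%ℕ-unique _ (suc p) _ (r ℕ.∸ t) (ℕ.s≤s (ℕP.≤-trans (ℕP.m∸n≤m r t) r≤p)) (begin
      + (r ℕ.+ m ℕ.* suc p) - + t             ≡⟨ cong (_- + t) (pos-+-* r m (suc p)) ⟩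
      + r + + m * + suc p - + t               ≡⟨ e (+ r) (+ t) (+ m) (+ suc p) ⟩
      + r - + t + (+ m + 1ℤ - 1ℤ) * + suc p   ≡⟨ cong (_+ (+ m + 1ℤ - 1ℤ) * + suc p) (pos-∸ t≤r) ⟩
      + (r ℕ.∸ t) + (+ m + 1ℤ - 1ℤ) * + suc p ∎))
    where
    open ≡-Reasoning
    e : ∀ r t m d → r + m * d - t ≡ r - t + (m + 1ℤ - 1ℤ) * d
    e = solve-∀
  ... | no t≰r rewrite 𝟙-≰ t≰r =
    proj₁ (/ℕ-%ℕ-unique _ (suc p) _ (r ℕ.+ suc p ℕ.∸ t) ρ<1+p (begin
      + (r ℕ.+ m ℕ.* suc p) - + t                       ≡⟨ cong (_- + t) (pos-+-* r m (suc p)) ⟩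
      + r + + m * + suc p - + t                         ≡⟨ e (+ r) (+ t) (+ m) (+ suc p) ⟩
      + (r ℕ.+ suc p) - + t + (+ m + 0ℤ - 1ℤ) * + suc p ≡⟨ cong (_+ (+ m + 0ℤ - 1ℤ) * + suc p) (pos-∸ t≤r+1+p) ⟩
      + (r ℕ.+ suc p ℕ.∸ t) + (+ m + 0ℤ - 1ℤ) * + suc p ∎))
    where
    open ≡-Reasoning
    e : ∀ r t m d → r + m * d - t ≡ r + d - t + (m + 0ℤ - 1ℤ) * d
    e = solve-∀
    t≤r+1+p : t ℕ.≤ r ℕ.+ suc p
    t≤r+1+p = ℕP.≤-trans t≤1+p (ℕP.m≤n+m (suc p) r)
    ρ<1+p : r ℕ.+ suc p ℕ.∸ t ℕ.< suc p
    ρ<1+p = ℕP.+-cancelʳ-< t _ _ (subst₂ ℕ._<_ (sym (ℕP.m∸n+n≡m t≤r+1+p)) (ℕP.+-comm t (suc p))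
                                     (ℕP.+-monoˡ-< (suc p) (ℕP.≰⇒> t≰r)))

  a-residue : ∀ p k0 s ρ → ρ ℕ.< suc (p ℕ.∸ 2) →
              k0 ℕ.+ suc (p ℕ.∸ 2) ≡ ρ ℕ.+ (2 ℕ.+ 2 ℕ.* s) → a p k0 s ≡ ρ
  a-residue p k0 s ρ ρ<d k0+d≡ρ+2+2s = proj₂ (/ℕ-%ℕ-unique _ d -1ℤ ρ ρ<d split)
    where
    d = suc (p ℕ.∸ 2)
    split : + k0 - + 2 - + (2 ℕ.* s) ≡ + ρ + -1ℤ * + d
    split = begin
      + k0 - + 2 - + (2 ℕ.* s)                  ≡⟨ e₁ (+ k0) (+ d) (+ (2 ℕ.* s)) ⟩
      + k0 + + d - + d - (+ 2 + + (2 ℕ.* s))    ≡⟨ cong (λ x → + x - + d - (+ 2 + + (2 ℕ.* s))) k0+d≡ρ+2+2s ⟩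
      + ρ + (+ 2 + + (2 ℕ.* s)) - + d - (+ 2 + + (2 ℕ.* s)) ≡⟨ e₂ (+ ρ) (+ d) (+ 2 + + (2 ℕ.* s)) ⟩
      + ρ + -1ℤ * + d                           ∎
      where
      open ≡-Reasoning
      e₁ : ∀ k d t → k - + 2 - t ≡ k + d - d - (+ 2 + t)
      e₁ = solve-∀
      e₂ : ∀ ρ d t → ρ + t - d - t ≡ ρ + -1ℤ * d
      e₂ = solve-∀

  durd-split : ∀ p k0 s m r → r ℕ.≤ p → t₁ p k0 s ℕ.≤ suc p → t₂ p k0 s ℕ.≤ suc p →
               durd p k0 s (r ℕ.+ m ℕ.* suc p) ≡ + m + + m + + excess p k0 s r
  durd-split p k0 s m r r≤p t₁≤1+p t₂≤1+p = begin
    durd p k0 s (r ℕ.+ m ℕ.* suc p)                        ≡⟨ cong₂ (λ x y → x + y + + 2 + + δ p k0 s)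
                                                                 (floorP1-shift p m r _ t₁≤1+p r≤p)
                                                                 (floorP1-shift p m r _ t₂≤1+p r≤p) ⟩
    (+ m + + i₁ - 1ℤ) + (+ m + + i₂ - 1ℤ) + + 2 + + δ p k0 s ≡⟨ e (+ m) (+ i₁) (+ i₂) (+ δ p k0 s) ⟩
    + m + + m + (+ δ p k0 s + + i₁ + + i₂)                  ∎
    where
    open ≡-Reasoning
    i₁ i₂ : ℕ
    i₁ = 𝟙[ t₁ p k0 s ≤ r ]
    i₂ = 𝟙[ t₂ p k0 s ≤ r ]
    e : ∀ m x y d → (m + x - 1ℤ) + (m + y - 1ℤ) + + 2 + d ≡ m + m + (d + x + y)
    e = solve-∀

module Thresholds where
  open import Data.Nat
  open Floor using (a-residue)

  ≤-offset : ∀ {m n} k → m + k ≡ n → m ≤ n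
  ≤-offset {m} k refl = ℕP.m≤m+n m k

  -- On S, the cases s + 2 ≤ k0 and k0 ≤ s + 1 are exactly the branches a_s + s ≥ p − 1 and
  -- a_s + s < p − 1 of the definition of t₁, t₂.
  record LowerShape (p k0 s : ℕ) : Set where
    field
      s+2≤k0    : s + 2 ≤ k0
      δ≡0       : δ p k0 s ≡ 0
      t₁+1+s≡k0 : t₁ p k0 s + suc s ≡ k0
      t₂≡1+s    : t₂ p k0 s ≡ suc s
      t₁≤t₂     : t₁ p k0 s ≤ t₂ p k0 s
      t₂≤1+p    : t₂ p k0 s ≤ suc p

  record UpperShape (p k0 s : ℕ) : Set where
    field
      k0≤1+s    : k0 ≤ suc s
      δ≡1       : δ p k0 s ≡ 1
      t₁≡1+s    : t₁ p k0 s ≡ suc s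
      t₂+s≡k0+p : t₂ p k0 s + s ≡ k0 + p
      t₁≤t₂     : t₁ p k0 s ≤ t₂ p k0 s
      t₂≤1+p    : t₂ p k0 s ≤ suc p

  module LowerCase (b c w : ℕ) (2b≤w : b + b ≤ w) where
    p k0 s : ℕ
    p  = 5 + c + w
    k0 = 5 + (b + b) + c
    s  = 3 + b + c

    private
      b≤w : b ≤ w
      b≤w = ℕP.≤-trans (ℕP.m≤m+n b b) 2b≤w

    a≡1+w : a p k0 s ≡ 1 + w
    a≡1+w = a-residue p k0 s (1 + w) (≤-offset (2 + c) (e₁ c w)) (e₂ b c w)
      where
      e₁ : ∀ c w → suc (1 + w) + (2 + c) ≡ 4 + c + w
      e₁ = ℕ-Solver.solve-∀
      e₂ : ∀ b c w → 5 + (b + b) + c + (4 + c + w) ≡ 1 + w + (2 + 2 * (3 + b + c))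
      e₂ = ℕ-Solver.solve-∀

    a+s≡b+[p-1] : a p k0 s + s ≡ b + (4 + c + w)
    a+s≡b+[p-1] = trans (cong (_+ s) a≡1+w) (e b c w)
      where
      e : ∀ b c w → 1 + w + (3 + b + c) ≡ b + (4 + c + w)
      e = ℕ-Solver.solve-∀

    res≡b : res p (ℤ.+ (a p k0 s + s)) ≡ b
    res≡b = trans (cong (_% (4 + c + w)) a+s≡b+[p-1])
                  (trans ([m+n]%n≡m%n b (4 + c + w)) (m<n⇒m%n≡m b<p-1))
      where
      e : ∀ b c x → suc b + (3 + c + x) ≡ 4 + c + (b + x)
      e = ℕ-Solver.solve-∀
      b<p-1 : b < 4 + c + w
      b<p-1 = ≤-offset (3 + c + (w ∸ b)) (trans (e b c (w ∸ b)) (cong (λ x → 4 + c + x) (ℕP.m+[n∸m]≡n b≤w)))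

    large : ¬ (a p k0 s + s < p ∸ 1)
    large = ℕP.≤⇒≯ (subst (4 + c + w ≤_) (sym a+s≡b+[p-1]) (ℕP.m≤n+m _ b))

    δ≡0 : δ p k0 s ≡ 0
    δ≡0 = if-yes (s + res p (ℤ.+ (a p k0 s + s)) <? p ∸ 1) (subst (λ r → s + r < p ∸ 1) (sym res≡b) s+b<p-1)
      where
      e : ∀ b c x → suc (3 + b + c + b) + x ≡ 4 + c + (b + b + x)
      e = ℕ-Solver.solve-∀
      s+b<p-1 : s + b < p ∸ 1
      s+b<p-1 = ≤-offset (w ∸ (b + b)) (trans (e b c (w ∸ (b + b))) (cong (λ x → 4 + c + x) (ℕP.m+[n∸m]≡n 2b≤w)))

    t₁≡1+b : t₁ p k0 s ≡ 1 + b
    t₁≡1+b = trans (if-no (a p k0 s + s <? p ∸ 1) large) (trans (cong₂ (λ r d → r + d + 1) res≡b δ≡0) (e b))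
      where
      e : ∀ b → b + 0 + 1 ≡ 1 + b
      e = ℕ-Solver.solve-∀

    t₂≡1+s : t₂ p k0 s ≡ suc s
    t₂≡1+s = trans (if-no (a p k0 s + s <? p ∸ 1) large) (trans (cong (λ d → s + d + 1) δ≡0) (e b c))
      where
      e : ∀ b c → 3 + b + c + 0 + 1 ≡ suc (3 + b + c)
      e = ℕ-Solver.solve-∀

    shape : LowerShape p k0 s
    shape = record
      { s+2≤k0    = ≤-offset b (e₁ b c)
      ; δ≡0       = δ≡0
      ; t₁+1+s≡k0 = trans (cong (_+ suc s) t₁≡1+b) (e₂ b c)
      ; t₂≡1+s    = t₂≡1+s
      ; t₁≤t₂     = subst₂ _≤_ (sym t₁≡1+b) (sym t₂≡1+s) (≤-offset (3 + c) (e₃ b c))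
      ; t₂≤1+p    = subst (_≤ suc p) (sym t₂≡1+s)
                      (≤-offset (2 + (w ∸ b)) (trans (e₄ b c (w ∸ b)) (cong (λ x → 6 + c + x) (ℕP.m+[n∸m]≡n b≤w))))
      }
      where
      e₁ : ∀ b c → 3 + b + c + 2 + b ≡ 5 + (b + b) + c
      e₁ = ℕ-Solver.solve-∀
      e₂ : ∀ b c → 1 + b + suc (3 + b + c) ≡ 5 + (b + b) + c
      e₂ = ℕ-Solver.solve-∀
      e₃ : ∀ b c → 1 + b + (3 + c) ≡ suc (3 + b + c)
      e₃ = ℕ-Solver.solve-∀
      e₄ : ∀ b c x → suc (3 + b + c) + (2 + x) ≡ 6 + c + (b + x)
      e₄ = ℕ-Solver.solve-∀

  module UpperCase (k c w : ℕ) where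
    p k0 s : ℕ
    p  = 4 + k + (c + c) + w
    k0 = 2 + k
    s  = 1 + k + c

    a≡1+w : a p k0 s ≡ 1 + w
    a≡1+w = a-residue p k0 s (1 + w) (≤-offset (1 + k + (c + c)) (e₁ k c w)) (e₂ k c w)
      where
      e₁ : ∀ k c w → suc (1 + w) + (1 + k + (c + c)) ≡ 3 + k + (c + c) + w
      e₁ = ℕ-Solver.solve-∀
      e₂ : ∀ k c w → 2 + k + (3 + k + (c + c) + w) ≡ 1 + w + (2 + 2 * (1 + k + c))
      e₂ = ℕ-Solver.solve-∀

    a+s≡2+w+k+c : a p k0 s + s ≡ 2 + w + k + c
    a+s≡2+w+k+c = trans (cong (_+ s) a≡1+w) (e k c w)
      where
      e : ∀ k c w → 1 + w + (1 + k + c) ≡ 2 + w + k + c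
      e = ℕ-Solver.solve-∀

    small : a p k0 s + s < p ∸ 1
    small = subst (_< p ∸ 1) (sym a+s≡2+w+k+c) (≤-offset c (e k c w))
      where
      e : ∀ k c w → suc (2 + w + k + c) + c ≡ 3 + k + (c + c) + w
      e = ℕ-Solver.solve-∀

    δ≡1 : δ p k0 s ≡ 1
    δ≡1 = if-no (s + res p (ℤ.+ (a p k0 s + s)) <? p ∸ 1)
            (ℕP.≤⇒≯ (subst (λ r → p ∸ 1 ≤ s + r) (sym (trans (m<n⇒m%n≡m small) a+s≡2+w+k+c))
                       (≤-offset k (e k c w))))
      where
      e : ∀ k c w → 3 + k + (c + c) + w + k ≡ 1 + k + c + (2 + w + k + c)
      e = ℕ-Solver.solve-∀

    t₁≡1+s : t₁ p k0 s ≡ suc s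
    t₁≡1+s = trans (if-yes (a p k0 s + s <? p ∸ 1) small) (trans (cong (s +_) δ≡1) (ℕP.+-comm s 1))

    t₂≡5+k+c+w : t₂ p k0 s ≡ 5 + k + c + w
    t₂≡5+k+c+w = trans (if-yes (a p k0 s + s <? p ∸ 1) small)
                       (trans (cong₂ (λ x d → x + d + 2) a+s≡2+w+k+c δ≡1) (e k c w))
      where
      e : ∀ k c w → 2 + w + k + c + 1 + 2 ≡ 5 + k + c + w
      e = ℕ-Solver.solve-∀

    shape : UpperShape p k0 s
    shape = record
      { k0≤1+s    = ≤-offset c (e₁ k c)
      ; δ≡1       = δ≡1
      ; t₁≡1+s    = t₁≡1+s
      ; t₂+s≡k0+p = trans (cong (_+ s) t₂≡5+k+c+w) (e₂ k c w)
      ; t₁≤t₂     = subst₂ _≤_ (sym t₁≡1+s) (sym t₂≡5+k+c+w) (≤-offset (3 + w) (e₃ k c w))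
      ; t₂≤1+p    = subst (_≤ suc p) (sym t₂≡5+k+c+w) (≤-offset c (e₄ k c w))
      }
      where
      e₁ : ∀ k c → 2 + k + c ≡ suc (1 + k + c)
      e₁ = ℕ-Solver.solve-∀
      e₂ : ∀ k c w → 5 + k + c + w + (1 + k + c) ≡ 2 + k + (4 + k + (c + c) + w)
      e₂ = ℕ-Solver.solve-∀
      e₃ : ∀ k c w → suc (1 + k + c) + (3 + w) ≡ 5 + k + c + w
      e₃ = ℕ-Solver.solve-∀
      e₄ : ∀ k c w → 5 + k + c + w + c ≡ suc (4 + k + (c + c) + w)
      e₄ = ℕ-Solver.solve-∀

  lowerShape : ∀ {p k0 s} b c w → b + b ≤ w →
               p ≡ 5 + c + w → k0 ≡ 5 + (b + b) + c → s ≡ 3 + b + c → LowerShape p k0 s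
  lowerShape b c w 2b≤w refl refl refl = LowerCase.shape b c w 2b≤w

  upperShape : ∀ {p k0 s} k c w → p ≡ 4 + k + (c + c) + w → k0 ≡ 2 + k → s ≡ 1 + k + c → UpperShape p k0 s
  upperShape k c w refl refl refl = UpperCase.shape k c w

  inS⇒k0<2s : ∀ {p k0 s} → inS p k0 s → k0 + 1 ≤ s + s
  inS⇒k0<2s {p} {k0} {s} (k0/2+1≤s , _) = ℕP.≤-pred (begin
    1 + (k0 + 1)                    ≡⟨ ℕP.+-comm 1 (k0 + 1) ⟩
    k0 + 1 + 1                      ≡⟨ ℕP.+-assoc k0 1 1 ⟩
    k0 + 2                          ≡⟨ m≡m%n+[m/n]*n (k0 + 2) 2 ⟩
    (k0 + 2) % 2 + (k0 + 2) / 2 * 2 ≤⟨ ℕP.+-mono-≤ (ℕP.≤-pred (m%n<n (k0 + 2) 2)) (ℕP.*-monoˡ-≤ 2 k0/2+1≤s) ⟩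
    1 + s * 2                       ≡⟨ cong suc (ℕP.*-comm s 2) ⟩
    1 + (s + (s + 0))               ≡⟨ cong (λ x → 1 + (s + x)) (ℕP.+-identityʳ s) ⟩
    1 + (s + s)                     ∎)
    where open ℕP.≤-Reasoning

  inS⇒2s+4≤k0+p : ∀ {p k0 s} → 7 ≤ p → inS p k0 s → s + s + 4 ≤ k0 + p
  inS⇒2s+4≤k0+p {p} {k0} {s} 7≤p (_ , s≤[k0+p-4]/2) = begin
    s + s + 4                     ≡⟨ cong (λ x → s + x + 4) (sym (ℕP.+-identityʳ s)) ⟩
    2 * s + 4                     ≡⟨ cong (_+ 4) (ℕP.*-comm 2 s) ⟩
    s * 2 + 4                     ≤⟨ ℕP.+-monoˡ-≤ 4 (ℕP.*-monoˡ-≤ 2 s≤[k0+p-4]/2) ⟩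
    (k0 + p ∸ 4) / 2 * 2 + 4      ≤⟨ ℕP.+-monoˡ-≤ 4 (m/n*n≤m (k0 + p ∸ 4) 2) ⟩
    k0 + p ∸ 4 + 4                ≡⟨ ℕP.m∸n+n≡m (ℕP.≤-trans (ℕP.≤-trans (ℕP.m≤n+m 4 3) 7≤p) (ℕP.m≤n+m p k0)) ⟩
    k0 + p                        ∎
    where open ℕP.≤-Reasoning

  shape-low : ∀ {p k0 s} → 7 ≤ p → k0 ≤ p → inS p k0 s → s + 2 ≤ k0 → LowerShape p k0 s
  shape-low {p} {k0} {s} 7≤p k0≤p s∈S s+2≤k0 = lowerShape b c w 2b≤w p≡ k0≡ s≡
    where
    b : ℕ
    b = k0 ∸ (s + 2)
    s+2+b≡k0 : s + 2 + b ≡ k0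
    s+2+b≡k0 = ℕP.m+[n∸m]≡n s+2≤k0
    b+3≤s : b + 3 ≤ s
    b+3≤s = ℕP.+-cancelˡ-≤ s _ _ (subst (_≤ s + s) (trans (cong (_+ 1) (sym s+2+b≡k0)) (e s b)) (inS⇒k0<2s s∈S))
      where
      e : ∀ s b → s + 2 + b + 1 ≡ s + (b + 3)
      e = ℕ-Solver.solve-∀
    c : ℕ
    c = s ∸ (b + 3)
    s≡ : s ≡ 3 + b + c
    s≡ = trans (sym (ℕP.m+[n∸m]≡n b+3≤s)) (cong (_+ c) (ℕP.+-comm b 3))
    k0≡ : k0 ≡ 5 + (b + b) + c
    k0≡ = trans (sym s+2+b≡k0) (trans (cong (λ x → x + 2 + b) s≡) (e b c))
      where
      e : ∀ b c → 3 + b + c + 2 + b ≡ 5 + (b + b) + c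
      e = ℕ-Solver.solve-∀
    5+c≤p : 5 + c ≤ p
    5+c≤p = ℕP.+-cancelˡ-≤ k0 _ _ (subst (_≤ k0 + p) 2s+4≡k0+5+c (inS⇒2s+4≤k0+p 7≤p s∈S))
      where
      e : ∀ b c → 3 + b + c + (3 + b + c) + 4 ≡ 5 + (b + b) + c + (5 + c)
      e = ℕ-Solver.solve-∀
      2s+4≡k0+5+c : s + s + 4 ≡ k0 + (5 + c)
      2s+4≡k0+5+c = trans (cong (λ x → x + x + 4) s≡) (trans (e b c) (cong (_+ (5 + c)) (sym k0≡)))
    w : ℕ
    w = p ∸ (5 + c)
    p≡ : p ≡ 5 + c + w
    p≡ = sym (ℕP.m+[n∸m]≡n 5+c≤p)
    2b≤w : b + b ≤ w
    2b≤w = ℕP.+-cancelˡ-≤ (5 + c) _ _ (subst₂ _≤_ (trans k0≡ (e b c)) p≡ k0≤p)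
      where
      e : ∀ b c → 5 + (b + b) + c ≡ 5 + c + (b + b)
      e = ℕ-Solver.solve-∀

  shape-high : ∀ {p k0 s} → 7 ≤ p → 2 ≤ k0 → inS p k0 s → ¬ s + 2 ≤ k0 → UpperShape p k0 s
  shape-high {p} {k0} {s} 7≤p 2≤k0 s∈S s+2≰k0 = upperShape k c w p≡ k0≡ s≡
    where
    k : ℕ
    k = k0 ∸ 2
    k0≡ : k0 ≡ 2 + k
    k0≡ = sym (ℕP.m+[n∸m]≡n 2≤k0)
    k0≤1+s : k0 ≤ 1 + s
    k0≤1+s = ℕP.≤-pred (subst (suc k0 ≤_) (ℕP.+-comm s 2) (ℕP.≰⇒> s+2≰k0))
    c : ℕ
    c = 1 + s ∸ k0
    s≡ : s ≡ 1 + k + c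
    s≡ = ℕP.suc-injective (trans (sym (ℕP.m+[n∸m]≡n k0≤1+s)) (cong (_+ c) k0≡))
    4+k+2c≤p : 4 + k + (c + c) ≤ p
    4+k+2c≤p = ℕP.+-cancelˡ-≤ k0 _ _ (subst (_≤ k0 + p) 2s+4≡k0+4+k+2c (inS⇒2s+4≤k0+p 7≤p s∈S))
      where
      e : ∀ k c → 1 + k + c + (1 + k + c) + 4 ≡ 2 + k + (4 + k + (c + c))
      e = ℕ-Solver.solve-∀
      2s+4≡k0+4+k+2c : s + s + 4 ≡ k0 + (4 + k + (c + c))
      2s+4≡k0+4+k+2c = trans (cong (λ x → x + x + 4) s≡) (trans (e k c) (cong (_+ (4 + k + (c + c))) (sym k0≡)))
    w : ℕ
    w = p ∸ (4 + k + (c + c))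
    p≡ : p ≡ 4 + k + (c + c) + w
    p≡ = sym (ℕP.m+[n∸m]≡n 4+k+2c≤p)

  Shape : ℕ → ℕ → ℕ → Set
  Shape p k0 s = LowerShape p k0 s ⊎ UpperShape p k0 s

  shape : ∀ {p k0 s} → 7 ≤ p → 2 ≤ k0 → k0 ≤ p → inS p k0 s → Shape p k0 s
  shape {p} {k0} {s} 7≤p 2≤k0 k0≤p s∈S with s + 2 ≤? k0
  ... | yes s+2≤k0 = inj₁ (shape-low 7≤p k0≤p s∈S s+2≤k0)
  ... | no s+2≰k0  = inj₂ (shape-high 7≤p 2≤k0 s∈S s+2≰k0)

  shape⇒t₁≤1+p : ∀ {p k0 s} → Shape p k0 s → t₁ p k0 s ≤ suc p
  shape⇒t₁≤1+p (inj₁ L) = ℕP.≤-trans (LowerShape.t₁≤t₂ L) (LowerShape.t₂≤1+p L)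
  shape⇒t₁≤1+p (inj₂ U) = ℕP.≤-trans (UpperShape.t₁≤t₂ U) (UpperShape.t₂≤1+p U)

  shape⇒t₂≤1+p : ∀ {p k0 s} → Shape p k0 s → t₂ p k0 s ≤ suc p
  shape⇒t₂≤1+p (inj₁ L) = LowerShape.t₂≤1+p L
  shape⇒t₂≤1+p (inj₂ U) = UpperShape.t₂≤1+p U

module Excess where
  open import Data.Nat
  open Tent using (EvenStep; stay; up; down)
  open Thresholds

  ≰-up : ∀ {x y r} → x ≤ y → ¬ x ≤ r → ¬ y ≤ r
  ≰-up x≤y x≰r y≤r = x≰r (ℕP.≤-trans x≤y y≤r)

  data Staircase : ℕ → ℕ → ℕ → ℕ → Set where
    none  : Staircase 0 0 0 0
    one   : Staircase 1 0 0 0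
    two   : Staircase 1 1 0 0
    three : Staircase 1 1 1 0
    all   : Staircase 1 1 1 1

  𝟙-staircase : ∀ {z₁ z₂ z₃ z₄} r → z₁ ≤ z₂ → z₂ ≤ z₃ → z₃ ≤ z₄ →
                Staircase 𝟙[ z₁ ≤ r ] 𝟙[ z₂ ≤ r ] 𝟙[ z₃ ≤ r ] 𝟙[ z₄ ≤ r ]
  𝟙-staircase {z₁} {z₂} {z₃} {z₄} r z₁≤z₂ z₂≤z₃ z₃≤z₄ with z₁ ≤? r
  ... | no z₁≰r
    rewrite 𝟙-≰ z₁≰r | 𝟙-≰ (≰-up z₁≤z₂ z₁≰r) | 𝟙-≰ (≰-up (ℕP.≤-trans z₁≤z₂ z₂≤z₃) z₁≰r)
          | 𝟙-≰ (≰-up (ℕP.≤-trans z₁≤z₂ (ℕP.≤-trans z₂≤z₃ z₃≤z₄)) z₁≰r)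
    = none
  ... | yes z₁≤r with z₂ ≤? r
  ... | no z₂≰r rewrite 𝟙-≤ z₁≤r | 𝟙-≰ z₂≰r | 𝟙-≰ (≰-up z₂≤z₃ z₂≰r) | 𝟙-≰ (≰-up (ℕP.≤-trans z₂≤z₃ z₃≤z₄) z₂≰r) = one
  ... | yes z₂≤r with z₃ ≤? r
  ... | no z₃≰r rewrite 𝟙-≤ z₁≤r | 𝟙-≤ z₂≤r | 𝟙-≰ z₃≰r | 𝟙-≰ (≰-up z₃≤z₄ z₃≰r) = two
  ... | yes z₃≤r with z₄ ≤? r
  ... | no z₄≰r rewrite 𝟙-≤ z₁≤r | 𝟙-≤ z₂≤r | 𝟙-≤ z₃≤r | 𝟙-≰ z₄≰r = three
  ... | yes z₄≤r rewrite 𝟙-≤ z₁≤r | 𝟙-≤ z₂≤r | 𝟙-≤ z₃≤r | 𝟙-≤ z₄≤r = all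

  evenStep-widen : ∀ {x₁ x₂ y₁ y₂} r → y₁ ≤ x₁ → x₁ ≤ x₂ → x₂ ≤ y₂ →
    EvenStep (ℤ.+ (𝟙[ x₁ ≤ r ] + 𝟙[ x₂ ≤ r ])) (ℤ.+ (𝟙[ y₁ ≤ r ] + 𝟙[ y₂ ≤ r ]))
  evenStep-widen {x₁} {x₂} {y₁} {y₂} r y₁≤x₁ x₁≤x₂ x₂≤y₂
    with 𝟙[ y₁ ≤ r ] | 𝟙[ x₁ ≤ r ] | 𝟙[ x₂ ≤ r ] | 𝟙[ y₂ ≤ r ] | 𝟙-staircase r y₁≤x₁ x₁≤x₂ x₂≤y₂
  ... | _ | _ | _ | _ | none  = stay
  ... | _ | _ | _ | _ | one   = up (ℤ.+ 0)
  ... | _ | _ | _ | _ | two   = stay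
  ... | _ | _ | _ | _ | three = down (ℤ.+ 1)
  ... | _ | _ | _ | _ | all   = stay

  evenStep-narrow : ∀ {x₁ x₂ y₁ y₂} r → x₁ ≤ y₁ → y₁ ≤ y₂ → y₂ ≤ x₂ →
    EvenStep (ℤ.+ (1 + 𝟙[ x₁ ≤ r ] + 𝟙[ x₂ ≤ r ])) (ℤ.+ (1 + 𝟙[ y₁ ≤ r ] + 𝟙[ y₂ ≤ r ]))
  evenStep-narrow {x₁} {x₂} {y₁} {y₂} r x₁≤y₁ y₁≤y₂ y₂≤x₂
    with 𝟙[ x₁ ≤ r ] | 𝟙[ y₁ ≤ r ] | 𝟙[ y₂ ≤ r ] | 𝟙[ x₂ ≤ r ] | 𝟙-staircase r x₁≤y₁ y₁≤y₂ y₂≤x₂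
  ... | _ | _ | _ | _ | none  = stay
  ... | _ | _ | _ | _ | one   = down (ℤ.+ 1)
  ... | _ | _ | _ | _ | two   = stay
  ... | _ | _ | _ | _ | three = up (ℤ.+ 1)
  ... | _ | _ | _ | _ | all   = stay

  evenStep-shift : ∀ {x₁ x₂ y₁ y₂} r → x₁ ≤ x₂ → x₂ ≤ y₁ → y₁ ≤ y₂ →
    EvenStep (ℤ.+ (𝟙[ x₁ ≤ r ] + 𝟙[ x₂ ≤ r ])) (ℤ.+ (1 + 𝟙[ y₁ ≤ r ] + 𝟙[ y₂ ≤ r ]))
  evenStep-shift {x₁} {x₂} {y₁} {y₂} r x₁≤x₂ x₂≤y₁ y₁≤y₂
    with 𝟙[ x₁ ≤ r ] | 𝟙[ x₂ ≤ r ] | 𝟙[ y₁ ≤ r ] | 𝟙[ y₂ ≤ r ] | 𝟙-staircase r x₁≤x₂ x₂≤y₁ y₁≤y₂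
  ... | _ | _ | _ | _ | none  = up (ℤ.+ 0)
  ... | _ | _ | _ | _ | one   = stay
  ... | _ | _ | _ | _ | two   = down (ℤ.+ 1)
  ... | _ | _ | _ | _ | three = stay
  ... | _ | _ | _ | _ | all   = up (ℤ.+ 1)

  excess-δ : ∀ p k0 s r {d} → δ p k0 s ≡ d → excess p k0 s r ≡ d + 𝟙[ t₁ p k0 s ≤ r ] + 𝟙[ t₂ p k0 s ≤ r ]
  excess-δ p k0 s r refl = refl

  evenStep-excess : ∀ {p k0 s s′} r → s ≤ s′ → Shape p k0 s → Shape p k0 s′ →
                    EvenStep (ℤ.+ excess p k0 s r) (ℤ.+ excess p k0 s′ r)
  evenStep-excess {p} {k0} {s} {s′} r s≤s′ (inj₁ L) (inj₁ L′) =
    subst₂ EvenStep (cong ℤ.+_ (sym (excess-δ p k0 s r (δ≡0 L)))) (cong ℤ.+_ (sym (excess-δ p k0 s′ r (δ≡0 L′))))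
      (evenStep-widen r t₁′≤t₁ (t₁≤t₂ L) (subst₂ _≤_ (sym (t₂≡1+s L)) (sym (t₂≡1+s L′)) (s≤s s≤s′)))
    where
    open LowerShape
    t₁′≤t₁ : t₁ p k0 s′ ≤ t₁ p k0 s
    t₁′≤t₁ = ℕP.+-cancelʳ-≤ (suc s) _ _ (begin
      t₁ p k0 s′ + suc s  ≤⟨ ℕP.+-monoʳ-≤ (t₁ p k0 s′) (s≤s s≤s′) ⟩
      t₁ p k0 s′ + suc s′ ≡⟨ trans (t₁+1+s≡k0 L′) (sym (t₁+1+s≡k0 L)) ⟩
      t₁ p k0 s + suc s   ∎)
      where open ℕP.≤-Reasoning
  evenStep-excess {p} {k0} {s} {s′} r s≤s′ (inj₁ L) (inj₂ U′) =
    subst₂ EvenStep (cong ℤ.+_ (sym (excess-δ p k0 s r (LowerShape.δ≡0 L)))) (cong ℤ.+_ (sym (excess-δ p k0 s′ r (UpperShape.δ≡1 U′))))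
      (evenStep-shift r (LowerShape.t₁≤t₂ L)
        (subst₂ _≤_ (sym (LowerShape.t₂≡1+s L)) (sym (UpperShape.t₁≡1+s U′)) (s≤s s≤s′)) (UpperShape.t₁≤t₂ U′))
  evenStep-excess {p} {k0} {s} {s′} r s≤s′ (inj₂ U) (inj₁ L′) =
    ⊥-elim (ℕP.<-irrefl refl (begin-strict
      k0        ≤⟨ UpperShape.k0≤1+s U ⟩
      suc s     ≤⟨ s≤s s≤s′ ⟩
      suc s′    <⟨ ℕP.n<1+n (suc s′) ⟩
      2 + s′    ≡⟨ ℕP.+-comm 2 s′ ⟩
      s′ + 2    ≤⟨ LowerShape.s+2≤k0 L′ ⟩
      k0        ∎))
    where open ℕP.≤-Reasoning
  evenStep-excess {p} {k0} {s} {s′} r s≤s′ (inj₂ U) (inj₂ U′) =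
    subst₂ EvenStep (cong ℤ.+_ (sym (excess-δ p k0 s r (δ≡1 U)))) (cong ℤ.+_ (sym (excess-δ p k0 s′ r (δ≡1 U′))))
      (evenStep-narrow r (subst₂ _≤_ (sym (t₁≡1+s U)) (sym (t₁≡1+s U′)) (s≤s s≤s′)) (t₁≤t₂ U′) t₂′≤t₂)
    where
    open UpperShape
    t₂′≤t₂ : t₂ p k0 s′ ≤ t₂ p k0 s
    t₂′≤t₂ = ℕP.+-cancelʳ-≤ s _ _ (begin
      t₂ p k0 s′ + s  ≤⟨ ℕP.+-monoʳ-≤ (t₂ p k0 s′) s≤s′ ⟩
      t₂ p k0 s′ + s′ ≡⟨ trans (t₂+s≡k0+p U′) (sym (t₂+s≡k0+p U)) ⟩
      t₂ p k0 s + s   ∎)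
      where open ℕP.≤-Reasoning

module Partition where
  open import Data.Nat
  open Tent using (EvenStep; stay; up; down)
  open Sums using (sumFin-cong; sumFin-const)

  stepAt : ℕ → ℕ → ℕ → ℕ → ℕ
  stepAt K A B x = if does (x ≤? K) then A else B

  stepAt-≤ : ∀ {K A B x} → x ≤ K → stepAt K A B x ≡ A
  stepAt-≤ {K} {x = x} = if-yes (x ≤? K)

  stepAt-> : ∀ {K A B x} → ¬ x ≤ K → stepAt K A B x ≡ B
  stepAt-> {K} {x = x} = if-no (x ≤? K)

  sumFin-stepAt : ∀ u K A B → K ≤ u →
    sumFin u (λ i → ℤ.+ stepAt K A B (suc (toℕ i))) ≡ ℤ.+ (K * A + (u ∸ K) * B)
  sumFin-stepAt zero    zero    A B z≤n = refl
  sumFin-stepAt (suc u) zero    A B z≤n =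
    cong (ℤ._+_ (ℤ.+ B)) (trans (sumFin-const u (ℤ.+ B)) (sym (ℤP.pos-* u B)))
  sumFin-stepAt (suc u) (suc K) A B (s≤s K≤u) =
    trans (cong (ℤ._+_ (ℤ.+ A)) (sumFin-stepAt u K A B K≤u)) (cong ℤ.+_ (sym (ℕP.+-assoc A (K * A) _)))

  evenStep-stepAt : ∀ {K A B x y} → x ≤ y → EvenStep (ℤ.+ A) (ℤ.+ B) →
                    EvenStep (ℤ.+ stepAt K A B x) (ℤ.+ stepAt K A B y)
  evenStep-stepAt {K} {A} {B} {x} {y} x≤y A~B with y ≤? K
  ... | yes y≤K = subst₂ EvenStep (cong ℤ.+_ (sym (stepAt-≤ (ℕP.≤-trans x≤y y≤K)))) (cong ℤ.+_ (sym (stepAt-≤ y≤K))) stay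
  ... | no y≰K with x ≤? K
  ...   | yes x≤K = subst₂ EvenStep (cong ℤ.+_ (sym (stepAt-≤ x≤K))) (cong ℤ.+_ (sym (stepAt-> y≰K))) A~B
  ...   | no x≰K  = subst₂ EvenStep (cong ℤ.+_ (sym (stepAt-> x≰K))) (cong ℤ.+_ (sym (stepAt-> y≰K))) stay

  evenStep-even : ∀ q → q % 2 ≡ 0 → EvenStep (ℤ.+ q) (ℤ.+ (q + 1))
  evenStep-even q q%2≡0 = subst (λ x → EvenStep (ℤ.+ x) (ℤ.+ (x + 1))) (sym q≡h+h) (up (ℤ.+ (q / 2)))
    where
    e : ∀ h → 0 + h * 2 ≡ h + h
    e = ℕ-Solver.solve-∀
    q≡h+h : q ≡ q / 2 + q / 2
    q≡h+h = trans (m≡m%n+[m/n]*n q 2) (trans (cong (_+ q / 2 * 2) q%2≡0) (e (q / 2)))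

  evenStep-odd : ∀ q → ¬ q % 2 ≡ 0 → EvenStep (ℤ.+ (q + 1)) (ℤ.+ q)
  evenStep-odd q q%2≢0 = subst₂ (λ x y → EvenStep (ℤ.+ x) (ℤ.+ y))
    (sym (trans (ℕP.+-comm q 1) 1+q≡)) (sym (ℕP.suc-injective 1+q≡)) (down (ℤ.+ suc (q / 2)))
    where
    e : ∀ h → suc (1 + h * 2) ≡ suc h + suc h
    e = ℕ-Solver.solve-∀
    q%2≡1 : q % 2 ≡ 1
    q%2≡1 with q % 2 | m%n<n q 2
    ... | zero        | _                 = ⊥-elim (q%2≢0 refl)
    ... | suc zero    | _                 = refl
    ... | suc (suc _) | s≤s (s≤s ())
    1+q≡ : suc q ≡ suc (q / 2) + suc (q / 2)
    1+q≡ = trans (cong suc (m≡m%n+[m/n]*n q 2)) (trans (cong (λ r → suc (r + q / 2 * 2)) q%2≡1) (e (q / 2)))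

  stepAt-cases : ∀ K A B x → stepAt K A B x ≡ A ⊎ stepAt K A B x ≡ B
  stepAt-cases K A B x with x ≤? K
  ... | yes x≤K = inj₁ (stepAt-≤ x≤K)
  ... | no x≰K  = inj₂ (stepAt-> x≰K)

  module _ (n v : ℕ) where
    private
      u q ρ : ℕ
      u = suc v
      q = n / u
      ρ = n % u
      ρ≤u : ρ ≤ u
      ρ≤u = ℕP.<⇒≤ (m%n<n n u)
      n≡ρ+q*u : n ≡ ρ + q * u
      n≡ρ+q*u = m≡m%n+[m/n]*n n u
      ρ[q+1]+[u-ρ]q≡n : ρ * (q + 1) + (u ∸ ρ) * q ≡ n
      ρ[q+1]+[u-ρ]q≡n = begin
        ρ * (q + 1) + (u ∸ ρ) * q ≡⟨ e ρ (u ∸ ρ) q ⟩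
        ρ + q * (ρ + (u ∸ ρ))     ≡⟨ cong (λ x → ρ + q * x) (ℕP.m+[n∸m]≡n ρ≤u) ⟩
        ρ + q * u                 ≡⟨ sym n≡ρ+q*u ⟩
        n                         ∎
        where
        open ≡-Reasoning
        e : ∀ ρ x q → ρ * (q + 1) + x * q ≡ ρ + q * (ρ + x)
        e = ℕ-Solver.solve-∀

    nui-even : q % 2 ≡ 0 → ∀ x → nui n u x ≡ stepAt (u ∸ ρ) q (q + 1) x
    nui-even q%2≡0 x = trans (if-yes (q % 2 ≟ 0) q%2≡0) (cong (λ K → stepAt K q (q + 1) x) K≡u-ρ)
      where
      e : ∀ u q → u * (q + 1) ≡ u + q * u
      e = ℕ-Solver.solve-∀
      K≡u-ρ : u * (q + 1) ∸ n ≡ u ∸ ρ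
      K≡u-ρ = begin
        u * (q + 1) ∸ n           ≡⟨ cong (_∸ n) (e u q) ⟩
        u + q * u ∸ n             ≡⟨ cong (λ x → x + q * u ∸ n) (sym (ℕP.m∸n+n≡m ρ≤u)) ⟩
        u ∸ ρ + ρ + q * u ∸ n     ≡⟨ cong (_∸ n) (trans (ℕP.+-assoc (u ∸ ρ) ρ (q * u)) (cong (u ∸ ρ +_) (sym n≡ρ+q*u))) ⟩
        u ∸ ρ + n ∸ n             ≡⟨ ℕP.m+n∸n≡m (u ∸ ρ) n ⟩
        u ∸ ρ                     ∎
        where open ≡-Reasoning

    nui-odd : ¬ q % 2 ≡ 0 → ∀ x → nui n u x ≡ stepAt ρ (q + 1) q x
    nui-odd q%2≢0 x = trans (if-no (q % 2 ≟ 0) q%2≢0) (cong (λ K → stepAt K (q + 1) q x) K≡ρ)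
      where
      K≡ρ : n ∸ u * q ≡ ρ
      K≡ρ = begin
        n ∸ u * q           ≡⟨ cong₂ _∸_ n≡ρ+q*u (ℕP.*-comm u q) ⟩
        ρ + q * u ∸ q * u   ≡⟨ ℕP.m+n∸n≡m ρ (q * u) ⟩
        ρ                   ∎
        where open ≡-Reasoning

    nui-sum : sumFin u (λ i → ℤ.+ nui n u (suc (toℕ i))) ≡ ℤ.+ n
    nui-sum with q % 2 ≟ 0
    ... | yes q%2≡0 = begin
      sumFin u (λ i → ℤ.+ nui n u (suc (toℕ i)))                   ≡⟨ sumFin-cong u (λ i → cong ℤ.+_ (nui-even q%2≡0 (suc (toℕ i)))) ⟩
      sumFin u (λ i → ℤ.+ stepAt (u ∸ ρ) q (q + 1) (suc (toℕ i)))  ≡⟨ sumFin-stepAt u (u ∸ ρ) q (q + 1) (ℕP.m∸n≤m u ρ) ⟩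
      ℤ.+ ((u ∸ ρ) * q + (u ∸ (u ∸ ρ)) * (q + 1))                  ≡⟨ cong (λ x → ℤ.+ ((u ∸ ρ) * q + x * (q + 1))) (ℕP.m∸[m∸n]≡n ρ≤u) ⟩
      ℤ.+ ((u ∸ ρ) * q + ρ * (q + 1))                              ≡⟨ cong ℤ.+_ (trans (ℕP.+-comm ((u ∸ ρ) * q) _) ρ[q+1]+[u-ρ]q≡n) ⟩
      ℤ.+ n                                                        ∎
      where open ≡-Reasoning
    ... | no q%2≢0 = begin
      sumFin u (λ i → ℤ.+ nui n u (suc (toℕ i)))                   ≡⟨ sumFin-cong u (λ i → cong ℤ.+_ (nui-odd q%2≢0 (suc (toℕ i)))) ⟩
      sumFin u (λ i → ℤ.+ stepAt ρ (q + 1) q (suc (toℕ i)))        ≡⟨ sumFin-stepAt u ρ (q + 1) q ρ≤u ⟩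
      ℤ.+ (ρ * (q + 1) + (u ∸ ρ) * q)                              ≡⟨ cong ℤ.+_ ρ[q+1]+[u-ρ]q≡n ⟩
      ℤ.+ n                                                        ∎
      where open ≡-Reasoning

    nui≡q⊎nui≡q+1 : ∀ x → nui n u x ≡ q ⊎ nui n u x ≡ q + 1
    nui≡q⊎nui≡q+1 x with q % 2 ≟ 0
    ... | yes q%2≡0 = Sum.map (trans (nui-even q%2≡0 x)) (trans (nui-even q%2≡0 x)) (stepAt-cases _ q (q + 1) x)
    ... | no q%2≢0  = Sum.swap (Sum.map (trans (nui-odd q%2≢0 x)) (trans (nui-odd q%2≢0 x)) (stepAt-cases ρ (q + 1) q x))

    nui-evenStep : ∀ {x y} → x ≤ y → EvenStep (ℤ.+ nui n u x) (ℤ.+ nui n u y)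
    nui-evenStep {x} {y} x≤y with q % 2 ≟ 0
    ... | yes q%2≡0 = subst₂ EvenStep (cong ℤ.+_ (sym (nui-even q%2≡0 x))) (cong ℤ.+_ (sym (nui-even q%2≡0 y)))
                             (evenStep-stepAt x≤y (evenStep-even q q%2≡0))
    ... | no q%2≢0  = subst₂ EvenStep (cong ℤ.+_ (sym (nui-odd q%2≢0 x))) (cong ℤ.+_ (sym (nui-odd q%2≢0 y)))
                             (evenStep-stepAt x≤y (evenStep-odd q q%2≢0))

    nui-sameSide : ∀ c → (∀ x → nui n u x ≤ c) ⊎ (∀ x → c ≤ nui n u x)
    nui-sameSide c with q + 1 ≤? c
    ... | yes q+1≤c = inj₁ (λ x → ℕP.≤-trans (nui≤q+1 x) q+1≤c)
      where
      nui≤q+1 : ∀ x → nui n u x ≤ q + 1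
      nui≤q+1 x with nui≡q⊎nui≡q+1 x
      ... | inj₁ nui≡q   = subst (_≤ q + 1) (sym nui≡q) (ℕP.m≤m+n q 1)
      ... | inj₂ nui≡q+1 = ℕP.≤-reflexive nui≡q+1
    ... | no q+1≰c = inj₂ (λ x → ℕP.≤-trans c≤q (q≤nui x))
      where
      c≤q : c ≤ q
      c≤q = ℕP.≤-pred (subst (suc c ≤_) (ℕP.+-comm q 1) (ℕP.≰⇒> q+1≰c))
      q≤nui : ∀ x → q ≤ nui n u x
      q≤nui x with nui≡q⊎nui≡q+1 x
      ... | inj₁ nui≡q   = ℕP.≤-reflexive (sym nui≡q)
      ... | inj₂ nui≡q+1 = subst (q ≤_) (sym nui≡q+1) (ℕP.m≤m+n q 1)

open Tent using (SignCompatible; tent; signCompatible-tent)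
open Sums using (mShape-sumFin)
open Floor using (durd-split)
open Thresholds using (Shape; shape; shape⇒t₁≤1+p; shape⇒t₂≤1+p)
open Excess using (evenStep-excess)
open Partition using (nui-sum; nui-sameSide; nui-evenStep)

dIwd≡ : ∀ j → dIwd j ≡ ℤ.+ suc j ℤ.+ ℤ.+ suc j
dIwd≡ j = cong ℤ.+_ (e j)
  where
  e : ∀ j → 2 ℕ.* j ℕ.+ 2 ≡ suc j ℕ.+ suc j
  e = ℕ-Solver.solve-∀

double-≤ : ∀ {a b} → a ℕ.≤ b → ℤ.+ a ℤ.+ ℤ.+ a ℤ.≤ ℤ.+ b ℤ.+ ℤ.+ b
double-≤ a≤b = ℤP.+-mono-≤ (ℤ.+≤+ a≤b) (ℤ.+≤+ a≤b)

open import Data.Nat using (_≤_)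

proposition3p20 : (p k0 : ℕ) → Prime p → 7 ≤ p → 2 ≤ k0 → k0 ≤ p →
    (n u : ℕ) → 1 ≤ u → (s : Fin u → ℕ) →
    (∀ i → inS p k0 (s i)) →
    (∀ i j → i F.≤ j → s i ≤ s j) →
    ∀ (j : ℕ) → gT p k0 n u s j ≡ prodFin u (λ i → g1 p k0 (nui n u (suc (toℕ i))) (s i)) j
proposition3p20 p k0 _ 7≤p 2≤k0 k0≤p n (suc v) _ s s∈S s-mono j =
  mShape-sumFin (suc v) D (dIwd j) ns n (nui-sum n v) sameSide ordered
  where
  r m : ℕ
  r = j % suc p
  m = j / suc p
  ns : Fin (suc v) → ℕ
  ns i = nui n (suc v) (suc (toℕ i))
  D : Fin (suc v) → ℤ.ℤ
  D i = durd p k0 (s i) j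
  shapeOf : ∀ i → Shape p k0 (s i)
  shapeOf i = shape 7≤p 2≤k0 k0≤p (s∈S i)
  D≡ : ∀ i → D i ≡ ℤ.+ m ℤ.+ ℤ.+ m ℤ.+ ℤ.+ excess p k0 (s i) r
  D≡ i = trans (cong (durd p k0 (s i)) (m≡m%n+[m/n]*n j (suc p)))
               (durd-split p k0 (s i) m r (ℕP.≤-pred (m%n<n j (suc p))) (shape⇒t₁≤1+p (shapeOf i)) (shape⇒t₂≤1+p (shapeOf i)))
  sameSide : (∀ i → ℤ.+ ns i ℤ.+ ℤ.+ ns i ℤ.≤ dIwd j) ⊎ (∀ i → dIwd j ℤ.≤ ℤ.+ ns i ℤ.+ ℤ.+ ns i)
  sameSide = Sum.map
    (λ ns≤1+j i → subst (ℤ.+ ns i ℤ.+ ℤ.+ ns i ℤ.≤_) (sym (dIwd≡ j)) (double-≤ (ns≤1+j (suc (toℕ i)))))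
    (λ 1+j≤ns i → subst (ℤ._≤ ℤ.+ ns i ℤ.+ ℤ.+ ns i) (sym (dIwd≡ j)) (double-≤ (1+j≤ns (suc (toℕ i)))))
    (nui-sameSide n v (suc j))
  ordered : ∀ i k → i F.≤ k → SignCompatible (tent (D i) (dIwd j) (ℤ.+ ns i)) (tent (D k) (dIwd j) (ℤ.+ ns k))
  ordered i k i≤k = subst₂ SignCompatible
    (cong₂ (λ d I → tent d I (ℤ.+ ns i)) (sym (D≡ i)) (sym (dIwd≡ j)))
    (cong₂ (λ d I → tent d I (ℤ.+ ns k)) (sym (D≡ k)) (sym (dIwd≡ j)))
    (signCompatible-tent (ℤ.+ suc j) (ℤ.+ m) (nui-evenStep n v (ℕ.s≤s i≤k))
      (evenStep-excess r (s-mono i k i≤k) (shapeOf i) (shapeOf k)))
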